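{- The language $Equal_{*}=\{aw\mid a\in\{\lambda,0,1\},\ w\in\{0,1\}^*,\ \#_0(w)=\#_1(w)\}$ over $\Sigma=\{0,1\}$ is $\mathrm{REG}/n$-primeimmune.
   Context: $\lambda$ is the empty string and $\#_b(w)$ is the number of occurrences of $b$ in $w$. A language $L$ over $\Sigma$ is p-dense if there exist $n_0$ and a non-zero polynomial $p$ with $|L\cap\Sigma^n|\ge|\Sigma^n|/p(n)$ for all $n\ge n_0$. For a family ${\cal C}$, $L$ is ${\cal C}$-primeimmune if $L$ is p-dense and $L$ has no p-dense subset belonging to ${\cal C}$. $\mathrm{REG}/n$ is the family of languages $L$ over $\Sigma$ for which there exist an alphabet $\Gamma$, $h:\mathbb{N}\to\Gamma^*$ with $|h(n)|=n$, and a regular language $A$ over $\Sigma\times\Gamma$ with $x\in L$ iff $\left[\begin{smallmatrix}x\\ h(|x|)\end{smallmatrix}\right]\in A$ for all $x$, where $\left[\begin{smallmatrix}x_1\cdots x_n\\ y_1\cdots y_n\end{smallmatrix}\right]=(x_1,y_1)\cdots(x_n,y_n)$. -}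

module Defs where

open import Data.Bool using (Bool; true; false; _∨_; if_then_else_)
open import Data.Nat using (ℕ; zero; suc; _+_; _*_; _^_; _≤_; _≡ᵇ_)
open import Data.Fin using (Fin)
open import Data.List using (List; []; _∷_; length; zip; map; _++_; foldr)
open import Data.Vec using (Vec)
open import Data.Vec as V using ()
open import Data.List.Relation.Unary.Any using (Any)
open import Data.Product using (Σ; _×_; ∃; ∃-syntax; _,_)
open import Relation.Binary.PropositionalEquality using (_≡_)
open import Relation.Nullary using (¬_)

-- Σ = {0,1} encoded as Bool: 0 ↦ false, 1 ↦ true.
-- A language over Σ is given by its characteristic function.
Lang : Set
Lang = List Bool → Bool

strings : ℕ → List (List Bool)
strings zero    = [] ∷ []
strings (suc n) = map (false ∷_) (strings n) ++ map (true ∷_) (strings n)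

census : Lang → ℕ → ℕ
census L n = foldr (λ w c → if L w then suc c else c) 0 (strings n)

-- polynomials with natural-number coefficients (constant term first)
Poly : Set
Poly = List ℕ

eval : Poly → ℕ → ℕ
eval []       x = 0
eval (c ∷ cs) x = c + x * eval cs x

NonZeroPoly : Poly → Set
NonZeroPoly p = Any (λ c → ¬ (c ≡ 0)) p

-- p-dense: |L ∩ Σ^n| ≥ |Σ^n| / p(n) for all n ≥ n0, written multiplicatively
PDense : Lang → Set
PDense L = Σ Poly λ p → NonZeroPoly p × Σ ℕ λ n₀ →
  ∀ n → n₀ ≤ n → 2 ^ n ≤ census L n * eval p n

record DFA (A : Set) : Set where
  field
    states : ℕ
    start  : Fin states
    δ      : Fin states → A → Fin states
    final  : Fin states → Bool

run : {A : Set} (M : DFA A) → Fin (DFA.states M) → List A → Fin (DFA.states M)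
run M q []       = q
run M q (a ∷ as) = run M (DFA.δ M q a) as

accepts : {A : Set} → DFA A → List A → Bool
accepts M w = DFA.final M (run M (DFA.start M) w)

-- REG/n: an alphabet Γ = Fin k, advice h with |h(n)| = n, and a regular
-- language A over Σ × Γ (given by a DFA) with x ∈ L iff [x ; h(|x|)] ∈ A.
REGn : Lang → Set
REGn L = Σ ℕ λ k → Σ ((n : ℕ) → Vec (Fin k) n) λ h → Σ (DFA (Bool × Fin k)) λ M →
  ∀ x → L x ≡ accepts M (zip x (V.toList (h (length x))))

_⊆_ : Lang → Lang → Set
S ⊆ L = ∀ x → S x ≡ true → L x ≡ true

REGn-primeimmune : Lang → Set
REGn-primeimmune L = PDense L × ¬ (Σ Lang λ S → REGn S × S ⊆ L × PDense S)

occ : Bool → List Bool → ℕ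
occ b []       = 0
occ b (c ∷ w)  = if eqB b c then suc (occ b w) else occ b w
  where
  eqB : Bool → Bool → Bool
  eqB true true = true
  eqB false false = true
  eqB _ _ = false

balanced : List Bool → Bool
balanced w = occ false w ≡ᵇ occ true w

-- Equal_* = { a w | a ∈ {λ,0,1}, #_0(w) = #_1(w) }
-- case a = λ : x itself is balanced; case a ∈ {0,1} : x = a ∷ w with w balanced
equalStar : Lang
equalStar x = balanced x ∨ afterFirst x
  where
  afterFirst : List Bool → Bool
  afterFirst []      = false
  afterFirst (a ∷ w) = balanced w

-- Equal_* is dense: among the strings of length 2m the balanced ones number C(2m, m), and
-- C(2m, m)(2m + 1) ≥ 4^m.
--
-- Conversely let S ⊆ Equal_* be accepted by an s-state automaton reading the advice alongside.
-- A string of S of even length has exactly half of its letters equal to 1. Cut the lengths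
-- n = tL into t blocks of length L = 2m with m = 4s² + 1 and fix the advice. For a first block
-- that extends to a string of S, the state it reaches together with one accepted continuation
-- from that state determines its number of ones; so at most s C(2m, m) ≤ 2^L / 2 first blocks
-- extend at all, the bound coming from C(2m, m)²(3m + 1) ≤ 16^m. Induction over the blocks gives
-- |S ∩ Σ^n| ≤ 2^n / 2^t, and for large t this beats 2^n / p(n) for every polynomial p.
module Submission where

open import Defs
open import Data.Bool using (Bool; true; false; _∨_; _∧_; if_then_else_; not)
open import Data.Bool.Properties using (∨-zeroʳ)
open import Data.Empty using (⊥; ⊥-elim)
open import Data.Fin using (Fin)
open import Data.Fin.Properties using () renaming (_≟_ to _≟ᶠ_)
open import Data.List using (List; []; _∷_; length; _++_; zip; map; foldr; allFin)
open import Data.List.Properties using (length-++; length-tabulate; map-cong)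
open import Data.List.Membership.Propositional using (_∈_)
open import Data.List.Membership.Propositional.Properties using (∈-allFin)
open import Data.List.Relation.Unary.Any using (here; there)
open import Data.Nat
open import Data.Nat.ListAction using (sum)
open import Data.Nat.Properties
open import Data.Nat.Tactic.RingSolver using (solve-∀)
open import Data.Product using (Σ; _×_; _,_)
open import Data.Sum using (_⊎_; inj₁; inj₂)
import Data.Vec as V
open import Data.Vec.Properties using (length-toList)
open import Function using (id)
open import Relation.Binary using (DecidableEquality)
open import Relation.Binary.PropositionalEquality
open import Relation.Nullary using (¬_; yes; no; does)
open import Relation.Nullary.Decidable using (dec-true)

count : Lang → List (List Bool) → ℕ
count P = foldr (λ w c → if P w then suc c else c) 0

count-++ : ∀ P xs ys → count P (xs ++ ys) ≡ count P xs + count P ys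
count-++ P []       ys = refl
count-++ P (x ∷ xs) ys with P x
... | true  = cong suc (count-++ P xs ys)
... | false = count-++ P xs ys

count-map : ∀ P (f : List Bool → List Bool) xs → count P (map f xs) ≡ count (λ w → P (f w)) xs
count-map P f []       = refl
count-map P f (x ∷ xs) with P (f x)
... | true  = cong suc (count-map P f xs)
... | false = count-map P f xs

census-suc : ∀ P n →
  census P (suc n) ≡ census (λ w → P (false ∷ w)) n + census (λ w → P (true ∷ w)) n
census-suc P n = trans (count-++ P (map (false ∷_) (strings n)) (map (true ∷_) (strings n)))
  (cong₂ _+_ (count-map P (false ∷_) (strings n)) (count-map P (true ∷_) (strings n)))

census-mono : ∀ n P Q → (∀ w → length w ≡ n → P w ≡ true → Q w ≡ true) →
  census P n ≤ census Q n
census-mono zero P Q P⇒Q with P [] in eq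
... | true  rewrite P⇒Q [] refl eq = ≤-refl
... | false = z≤n
census-mono (suc n) P Q P⇒Q rewrite census-suc P n | census-suc Q n =
  +-mono-≤ (census-mono n _ _ (λ w e → P⇒Q (false ∷ w) (cong suc e)))
           (census-mono n _ _ (λ w e → P⇒Q (true ∷ w) (cong suc e)))

census-cong : ∀ n P Q → (∀ w → length w ≡ n → P w ≡ Q w) → census P n ≡ census Q n
census-cong n P Q P≡Q = ≤-antisym (census-mono n P Q (λ w e p → trans (sym (P≡Q w e)) p))
                                  (census-mono n Q P (λ w e q → trans (P≡Q w e) q))

census-≡0 : ∀ n P → (∀ w → length w ≡ n → P w ≡ false) → census P n ≡ 0
census-≡0 zero P ¬P rewrite ¬P [] refl = refl
census-≡0 (suc n) P ¬P rewrite census-suc P n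
  | census-≡0 n _ (λ w e → ¬P (false ∷ w) (cong suc e))
  | census-≡0 n _ (λ w e → ¬P (true ∷ w) (cong suc e)) = refl

census≢0⇒witness : ∀ n P → census P n ≢ 0 → Σ (List Bool) λ w → length w ≡ n × P w ≡ true
census≢0⇒witness zero P ≢0 with P [] in eq
... | true  = [] , refl , eq
... | false = ⊥-elim (≢0 refl)
census≢0⇒witness (suc n) P ≢0 with census (λ w → P (false ∷ w)) n ≟ 0
... | no ≢0₀ = let w , e , p = census≢0⇒witness n _ ≢0₀ in false ∷ w , cong suc e , p
... | yes ≡0₀ with census (λ w → P (true ∷ w)) n ≟ 0
...   | no ≢0₁  = let w , e , p = census≢0⇒witness n _ ≢0₁ in true ∷ w , cong suc e , p
...   | yes ≡0₁ = ⊥-elim (≢0 (trans (census-suc P n) (cong₂ _+_ ≡0₀ ≡0₁)))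

census-++-≤ : ∀ a b P Q c B →
  (∀ w₁ → length w₁ ≡ a → census (λ w₂ → P (w₁ ++ w₂)) b * c ≤ (if Q w₁ then B else 0)) →
  census P (a + b) * c ≤ census Q a * B
census-++-≤ zero b P Q c B bound with Q [] | bound [] refl
... | true  | le = ≤-trans le (≤-reflexive (sym (+-identityʳ B)))
... | false | le = le
census-++-≤ (suc a) b P Q c B bound rewrite census-suc P (a + b) | census-suc Q a =
  begin
    (P₀ + P₁) * c      ≡⟨ *-distribʳ-+ c P₀ P₁ ⟩
    P₀ * c + P₁ * c    ≤⟨ +-mono-≤ (census-++-≤ a b _ _ c B (λ w₁ e → bound (false ∷ w₁) (cong suc e)))
                                   (census-++-≤ a b _ _ c B (λ w₁ e → bound (true ∷ w₁) (cong suc e))) ⟩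
    Q₀ * B + Q₁ * B    ≡⟨ *-distribʳ-+ B Q₀ Q₁ ⟨
    (Q₀ + Q₁) * B      ∎
  where
  open ≤-Reasoning
  P₀ = census (λ w → P (false ∷ w)) (a + b)
  P₁ = census (λ w → P (true ∷ w)) (a + b)
  Q₀ = census (λ w → Q (false ∷ w)) a
  Q₁ = census (λ w → Q (true ∷ w)) a

sum-map-+ : {A : Set} (F G : A → ℕ) (is : List A) →
  sum (map (λ i → F i + G i) is) ≡ sum (map F is) + sum (map G is)
sum-map-+ F G []       = refl
sum-map-+ F G (i ∷ is) rewrite sum-map-+ F G is = +-+-comm (F i) (G i) _ _
  where
  +-+-comm : ∀ a b c d → a + b + (c + d) ≡ a + c + (b + d)
  +-+-comm = solve-∀

sum-map-≤ : {A : Set} (F : A → ℕ) (X : ℕ) (is : List A) → (∀ i → F i ≤ X) →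
  sum (map F is) ≤ length is * X
sum-map-≤ F X []       F≤X = z≤n
sum-map-≤ F X (i ∷ is) F≤X = +-mono-≤ (F≤X i) (sum-map-≤ F X is F≤X)

∈⇒≤sum-map : {A : Set} (F : A → ℕ) {i : A} {is : List A} → i ∈ is → F i ≤ sum (map F is)
∈⇒≤sum-map F (here refl) = m≤m+n _ _
∈⇒≤sum-map F (there i∈) = ≤-trans (∈⇒≤sum-map F i∈) (m≤n+m _ _)

module _ {A : Set} (_≟_ : DecidableEquality A) where

  fibre : (List Bool → A) → Lang → A → Lang
  fibre f P i w = P w ∧ does (f w ≟ i)

  census-≤-sum-fibres : ∀ n P (f : List Bool → A) (is : List A) → (∀ w → f w ∈ is) →
    census P n ≤ sum (map (λ i → census (fibre f P i) n) is)
  census-≤-sum-fibres zero P f is cover =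
    ≤-trans (census-mono 0 P (fibre f P (f [])) P⇒fibre)
            (∈⇒≤sum-map (λ i → census (fibre f P i) 0) (cover []))
    where
    P⇒fibre : ∀ w → length w ≡ 0 → P w ≡ true → fibre f P (f []) w ≡ true
    P⇒fibre [] _ p = cong₂ _∧_ p (dec-true (f [] ≟ f []) refl)
  census-≤-sum-fibres (suc n) P f is cover rewrite census-suc P n =
    begin
      census P₀ n + census P₁ n
        ≤⟨ +-mono-≤ (census-≤-sum-fibres n P₀ (λ w → f (false ∷ w)) is (λ _ → cover _))
                    (census-≤-sum-fibres n P₁ (λ w → f (true ∷ w)) is (λ _ → cover _)) ⟩
      sum (map (λ i → census (λ w → fibre f P i (false ∷ w)) n) is)
        + sum (map (λ i → census (λ w → fibre f P i (true ∷ w)) n) is)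
        ≡⟨ sum-map-+ _ _ is ⟨
      sum (map (λ i → census (λ w → fibre f P i (false ∷ w)) n
                    + census (λ w → fibre f P i (true ∷ w)) n) is)
        ≡⟨ cong sum (map-cong (λ i → census-suc (fibre f P i) n) is) ⟨
      sum (map (λ i → census (fibre f P i) (suc n)) is)
    ∎
    where
    open ≤-Reasoning
    P₀ P₁ : Lang
    P₀ w = P (false ∷ w)
    P₁ w = P (true ∷ w)

  fibre-true : ∀ f P i w → fibre f P i w ≡ true → P w ≡ true × f w ≡ i
  fibre-true f P i w p with P w | f w ≟ i
  ... | true | yes fw≡i = refl , fw≡i

  census-≤-#fibres : ∀ n P (f : List Bool → A) (is : List A) (X : ℕ) → (∀ w → f w ∈ is) →
    (∀ i → census (fibre f P i) n ≤ X) → census P n ≤ length is * X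
  census-≤-#fibres n P f is X cover bound =
    ≤-trans (census-≤-sum-fibres n P f is cover) (sum-map-≤ _ X is bound)

-- Binomial coefficients

-- binom a b is (a + b choose a), indexed by the two parts.
binom : ℕ → ℕ → ℕ
binom zero    b       = 1
binom (suc a) zero    = 1
binom (suc a) (suc b) = binom a (suc b) + binom (suc a) b

binom-zeroʳ : ∀ a → binom a 0 ≡ 1
binom-zeroʳ zero    = refl
binom-zeroʳ (suc a) = refl

binom-comm : ∀ a b → binom a b ≡ binom b a
binom-comm zero    b       = sym (binom-zeroʳ b)
binom-comm (suc a) zero    = refl
binom-comm (suc a) (suc b) rewrite binom-comm a (suc b) | binom-comm (suc a) b =
  +-comm (binom (suc b) a) (binom b (suc a))

binom-oneˡ : ∀ b → binom 1 b ≡ suc b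
binom-oneˡ zero    = refl
binom-oneˡ (suc b) = cong suc (binom-oneˡ b)

binom-absorbˡ : ∀ a b → binom (suc a) b * suc a ≡ (suc a + b) * binom a b
binom-absorbˡ a zero rewrite binom-zeroʳ a =
  trans (*-comm 1 (suc a)) (cong (_* 1) (sym (+-identityʳ (suc a))))
binom-absorbˡ zero (suc b) = cong (λ z → suc (z * 1)) (binom-oneˡ b)
binom-absorbˡ (suc a) (suc b) =
  begin
    (X + W) * (2 + a)               ≡⟨ expand X W a ⟩
    X + X * (1 + a) + W * (2 + a)   ≡⟨ cong₂ (λ u v → X + u + v)
                                        (trans (binom-absorbˡ a (suc b)) (cong (λ z → suc z * Y) (+-suc a b)))
                                        (binom-absorbˡ (suc a) b) ⟩
    X + k * Y + k * Z               ≡⟨ collect Y Z a b ⟩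
    (3 + a + b) * X                 ≡⟨ cong (λ z → suc (suc z) * X) (+-suc a b) ⟨
    (suc (suc a) + suc b) * X       ∎
  where
  open ≡-Reasoning
  Y = binom a (suc b)
  Z = binom (suc a) b
  X = Y + Z
  W = binom (suc (suc a)) b
  k = 2 + a + b
  expand : ∀ X W a → (X + W) * (2 + a) ≡ X + X * (1 + a) + W * (2 + a)
  expand = solve-∀
  collect : ∀ Y Z a b → Y + Z + (2 + a + b) * Y + (2 + a + b) * Z ≡ (3 + a + b) * (Y + Z)
  collect = solve-∀

binom-absorbʳ : ∀ a b → binom a (suc b) * suc b ≡ (a + suc b) * binom a b
binom-absorbʳ a b rewrite binom-comm a (suc b) | binom-comm a b =
  trans (binom-absorbˡ b a) (cong (_* binom b a) (+-comm (suc b) a))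

binom-shift : ∀ a b → a ≤ b → binom a (suc b) ≤ binom (suc a) b
binom-shift a b a≤b = *-cancelʳ-≤ (binom a (suc b)) (binom (suc a) b) (suc a) (begin
    binom a (suc b) * suc a    ≤⟨ *-monoʳ-≤ (binom a (suc b)) (s≤s a≤b) ⟩
    binom a (suc b) * suc b    ≡⟨ binom-absorbʳ a b ⟩
    (a + suc b) * binom a b    ≡⟨ cong (_* binom a b) (+-suc a b) ⟩
    (suc a + b) * binom a b    ≡⟨ binom-absorbˡ a b ⟨
    binom (suc a) b * suc a    ∎)
  where open ≤-Reasoning

binom-toward-centre : ∀ d a → binom a (a + d + d) ≤ binom (a + d) (a + d)
binom-toward-centre zero a rewrite +-identityʳ a | +-identityʳ a = ≤-refl
binom-toward-centre (suc d) a = begin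
    binom a (a + suc d + suc d)           ≡⟨ cong (binom a) (unfold a d) ⟩
    binom a (suc (suc (a + d + d)))       ≤⟨ binom-shift a (suc (a + d + d)) (m≤n⇒m≤1+n (≤-trans (m≤m+n a d) (m≤m+n (a + d) d))) ⟩
    binom (suc a) (suc a + d + d)         ≤⟨ binom-toward-centre d (suc a) ⟩
    binom (suc a + d) (suc a + d)         ≡⟨ cong (λ z → binom z z) (+-suc a d) ⟨
    binom (a + suc d) (a + suc d)         ∎
  where
  open ≤-Reasoning
  unfold : ∀ a d → a + suc d + suc d ≡ suc (suc (a + d + d))
  unfold = solve-∀

binom≤central-on-left : ∀ m j r → j + r ≡ m + m → j ≤ m → binom j r ≤ binom m m
binom≤central-on-left m j r j+r≡2m j≤m =
  subst (λ z → binom j r ≤ binom z z) j+d≡m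
    (subst (λ z → binom j z ≤ binom (j + d) (j + d)) j+d+d≡r (binom-toward-centre d j))
  where
  d = m ∸ j
  j+d≡m : j + d ≡ m
  j+d≡m = m+[n∸m]≡n j≤m
  j+d+d≡r : j + d + d ≡ r
  j+d+d≡r = +-cancelˡ-≡ j (j + d + d) r (begin
    j + (j + d + d)        ≡⟨ regroup j d ⟩
    (j + d) + (j + d)      ≡⟨ cong₂ _+_ j+d≡m j+d≡m ⟩
    m + m                  ≡⟨ j+r≡2m ⟨
    j + r                  ∎)
    where
    open ≡-Reasoning
    regroup : ∀ j d → j + (j + d + d) ≡ (j + d) + (j + d)
    regroup = solve-∀

binom≤central : ∀ m j r → j + r ≡ m + m → binom j r ≤ binom m m
binom≤central m j r j+r≡2m with j ≤? m | r ≤? m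
... | yes j≤m | _       = binom≤central-on-left m j r j+r≡2m j≤m
... | no _    | yes r≤m = subst (_≤ binom m m) (binom-comm r j)
                            (binom≤central-on-left m r j (trans (+-comm r j) j+r≡2m) r≤m)
... | no j≰m  | no r≰m  = ⊥-elim (<-irrefl (sym j+r≡2m) (+-mono-< (≰⇒> j≰m) (≰⇒> r≰m)))

central-binom-suc : ∀ m → binom (suc m) (suc m) * suc m ≡ 2 * (m + suc m) * binom m m
central-binom-suc m = begin
    binom (suc m) (suc m) * suc m       ≡⟨ binom-absorbˡ m (suc m) ⟩
    (suc m + suc m) * binom m (suc m)   ≡⟨ double (binom m (suc m)) m ⟩
    2 * (binom m (suc m) * suc m)       ≡⟨ cong (2 *_) (binom-absorbʳ m m) ⟩
    2 * ((m + suc m) * binom m m)       ≡⟨ *-assoc 2 (m + suc m) (binom m m) ⟨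
    2 * (m + suc m) * binom m m         ∎
  where
  open ≡-Reasoning
  double : ∀ y m → (suc m + suc m) * y ≡ 2 * (y * suc m)
  double = solve-∀

central-binom-lower : ∀ m → 4 ^ m ≤ binom m m * (m + suc m)
central-binom-lower zero    = ≤-refl
central-binom-lower (suc m) = *-cancelʳ-≤ (4 ^ suc m) (c′ * (suc m + suc (suc m))) (suc m) (begin
    4 * 4 ^ m * suc m                    ≤⟨ *-monoˡ-≤ (suc m) (*-monoʳ-≤ 4 (central-binom-lower m)) ⟩
    4 * (c * e) * suc m                  ≡⟨ regroup c e m ⟩
    2 * e * c * (2 * suc m)              ≤⟨ *-monoʳ-≤ (2 * e * c) (two-m≤ m) ⟩
    2 * e * c * (suc m + suc (suc m))    ≡⟨ cong (_* (suc m + suc (suc m))) (central-binom-suc m) ⟨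
    c′ * suc m * (suc m + suc (suc m))   ≡⟨ *-right-comm c′ (suc m) (suc m + suc (suc m)) ⟩
    c′ * (suc m + suc (suc m)) * suc m   ∎)
  where
  open ≤-Reasoning
  c′ = binom (suc m) (suc m)
  c  = binom m m
  e  = m + suc m
  regroup : ∀ c e m → 4 * (c * e) * suc m ≡ 2 * e * c * (2 * suc m)
  regroup = solve-∀
  two-m≤ : ∀ m → 2 * suc m ≤ suc m + suc (suc m)
  two-m≤ m = subst (_≤ suc m + suc (suc m)) (sym (cong (suc m +_) (+-identityʳ (suc m))))
               (+-monoʳ-≤ (suc m) (n≤1+n (suc m)))
  *-right-comm : ∀ x y z → x * y * z ≡ x * z * y
  *-right-comm = solve-∀

-- The factor 3m + 1 is what lets the induction close: (2m + 1)²(3m + 4) + m = 4(m + 1)²(3m + 1).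
central-binom-upper : ∀ m → binom m m * binom m m * (3 * m + 1) ≤ 16 ^ m
central-binom-upper zero    = ≤-refl
central-binom-upper (suc m) = *-cancelʳ-≤ (c′ * c′ * (3 * suc m + 1)) (16 ^ suc m) (suc m * suc m) (begin
    c′ * c′ * (3 * suc m + 1) * (suc m * suc m)         ≡⟨ regroup₁ c′ m ⟩
    (c′ * suc m) * (c′ * suc m) * (3 * suc m + 1)       ≡⟨ cong (λ z → z * z * (3 * suc m + 1)) (central-binom-suc m) ⟩
    (2 * e * c) * (2 * e * c) * (3 * suc m + 1)         ≡⟨ regroup₂ e c (3 * suc m + 1) ⟩
    4 * (c * c) * (e * e * (3 * suc m + 1))             ≤⟨ *-monoʳ-≤ (4 * (c * c)) (≤-trans (m≤m+n _ m) (≤-reflexive (step m))) ⟩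
    4 * (c * c) * (4 * (suc m * suc m) * (3 * m + 1))   ≡⟨ regroup₃ c (suc m * suc m) (3 * m + 1) ⟩
    16 * (suc m * suc m) * (c * c * (3 * m + 1))        ≤⟨ *-monoʳ-≤ (16 * (suc m * suc m)) (central-binom-upper m) ⟩
    16 * (suc m * suc m) * 16 ^ m                       ≡⟨ regroup₄ (suc m * suc m) (16 ^ m) ⟩
    16 * 16 ^ m * (suc m * suc m)                       ∎)
  where
  open ≤-Reasoning
  c′ = binom (suc m) (suc m)
  c  = binom m m
  e  = m + suc m
  regroup₁ : ∀ x s → x * x * (3 * suc s + 1) * (suc s * suc s) ≡ (x * suc s) * (x * suc s) * (3 * suc s + 1)
  regroup₁ = solve-∀
  regroup₂ : ∀ e c k → (2 * e * c) * (2 * e * c) * k ≡ 4 * (c * c) * (e * e * k)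
  regroup₂ = solve-∀
  regroup₃ : ∀ c q k → 4 * (c * c) * (4 * q * k) ≡ 16 * q * (c * c * k)
  regroup₃ = solve-∀
  regroup₄ : ∀ q x → 16 * q * x ≡ 16 * x * q
  regroup₄ = solve-∀
  step : ∀ m → (m + suc m) * (m + suc m) * (3 * suc m + 1) + m ≡ 4 * (suc m * suc m) * (3 * m + 1)
  step = solve-∀

≡ᵇ-true⇒≡ : ∀ x y → (x ≡ᵇ y) ≡ true → x ≡ y
≡ᵇ-true⇒≡ zero    zero    _ = refl
≡ᵇ-true⇒≡ (suc x) (suc y) e = cong suc (≡ᵇ-true⇒≡ x y e)

≡⇒≡ᵇ-true : ∀ x y → x ≡ y → (x ≡ᵇ y) ≡ true
≡⇒≡ᵇ-true zero    zero    _ = refl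
≡⇒≡ᵇ-true (suc x) (suc y) e = ≡⇒≡ᵇ-true x y (suc-injective e)

<⇒≡ᵇ-false : ∀ x y → x < y → (x ≡ᵇ y) ≡ false
<⇒≡ᵇ-false zero    (suc y) _         = refl
<⇒≡ᵇ-false (suc x) (suc y) (s<s x<y) = <⇒≡ᵇ-false x y x<y

ones : List Bool → ℕ
ones = occ true

occ-false+ones : ∀ w → occ false w + ones w ≡ length w
occ-false+ones []          = refl
occ-false+ones (false ∷ w) = cong suc (occ-false+ones w)
occ-false+ones (true ∷ w)  = trans (+-suc (occ false w) (ones w)) (cong suc (occ-false+ones w))

ones-++ : ∀ u v → ones (u ++ v) ≡ ones u + ones v
ones-++ []          v = refl
ones-++ (false ∷ u) v = ones-++ u v
ones-++ (true ∷ u)  v = cong suc (ones-++ u v)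

ones≤length : ∀ w → ones w ≤ length w
ones≤length []          = z≤n
ones≤length (false ∷ w) = m≤n⇒m≤1+n (ones≤length w)
ones≤length (true ∷ w)  = s≤s (ones≤length w)

withOnes : ℕ → Lang
withOnes j w = ones w ≡ᵇ j

census-withOnes-> : ∀ n j → n < j → census (withOnes j) n ≡ 0
census-withOnes-> n j n<j = census-≡0 n (withOnes j)
  (λ w e → <⇒≡ᵇ-false (ones w) j (≤-<-trans (ones≤length w) (subst (_< j) (sym e) n<j)))

census-withOnes : ∀ a b → census (withOnes a) (a + b) ≡ binom a b
census-withOnes zero zero = refl
census-withOnes zero (suc b) =
  trans (census-suc (withOnes 0) b)
        (cong₂ _+_ (census-withOnes zero b) (census-≡0 b _ (λ _ _ → refl)))
census-withOnes (suc a) zero rewrite +-identityʳ a =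
  trans (census-suc (withOnes (suc a)) a)
        (cong₂ _+_ (census-withOnes-> a (suc a) ≤-refl)
                   (subst (λ n → census (withOnes a) n ≡ 1) (+-identityʳ a)
                          (trans (census-withOnes a zero) (binom-zeroʳ a))))
census-withOnes (suc a) (suc b) =
  trans (census-suc (withOnes (suc a)) (a + suc b))
        (trans (cong₂ _+_ (trans (cong (census (withOnes (suc a))) (+-suc a b)) (census-withOnes (suc a) b))
                          (census-withOnes a (suc b)))
               (+-comm (binom (suc a) b) (binom a (suc b))))

census-withOnes≤central : ∀ m j → census (withOnes j) (m + m) ≤ binom m m
census-withOnes≤central m j with j ≤? m + m
... | yes j≤2m = begin
    census (withOnes j) (m + m)           ≡⟨ cong (census (withOnes j)) j+r≡2m ⟨
    census (withOnes j) (j + (m + m ∸ j)) ≡⟨ census-withOnes j (m + m ∸ j) ⟩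
    binom j (m + m ∸ j)                   ≤⟨ binom≤central m j (m + m ∸ j) j+r≡2m ⟩
    binom m m                             ∎
  where
  open ≤-Reasoning
  j+r≡2m : j + (m + m ∸ j) ≡ m + m
  j+r≡2m = m+[n∸m]≡n j≤2m
... | no j≰2m rewrite census-withOnes-> (m + m) j (≰⇒> j≰2m) = z≤n

-- Density of Equal_*

even-or-odd : ∀ n → Σ ℕ λ m → n ≡ m + m ⊎ n ≡ suc (m + m)
even-or-odd zero = 0 , inj₁ refl
even-or-odd (suc n) with even-or-odd n
... | m , inj₁ n≡2m  = m , inj₂ (cong suc n≡2m)
... | m , inj₂ n≡2m+1 = suc m , inj₁ (trans (cong suc n≡2m+1) (cong suc (sym (+-suc m m))))

2^[m+m]≡4^m : ∀ m → 2 ^ (m + m) ≡ 4 ^ m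
2^[m+m]≡4^m zero = refl
2^[m+m]≡4^m (suc m) rewrite +-suc m m | 2^[m+m]≡4^m m = sym (*-assoc 2 2 (4 ^ m))

withOnes-half⇒balanced : ∀ m w → length w ≡ m + m → withOnes m w ≡ true → balanced w ≡ true
withOnes-half⇒balanced m w len≡2m ones≡m =
  ≡⇒≡ᵇ-true (occ false w) (ones w) (trans zeros≡m (sym ones≡m′))
  where
  ones≡m′ : ones w ≡ m
  ones≡m′ = ≡ᵇ-true⇒≡ (ones w) m ones≡m
  zeros≡m : occ false w ≡ m
  zeros≡m = +-cancelʳ-≡ m (occ false w) m
    (trans (cong (occ false w +_) (sym ones≡m′)) (trans (occ-false+ones w) len≡2m))

binom≤census-equalStar-even : ∀ m → binom m m ≤ census equalStar (m + m)
binom≤census-equalStar-even m = subst (_≤ census equalStar (m + m)) (census-withOnes m m)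
  (census-mono (m + m) (withOnes m) equalStar withOnes-half⇒equalStar)
  where
  withOnes-half⇒equalStar : ∀ w → length w ≡ m + m → withOnes m w ≡ true → equalStar w ≡ true
  withOnes-half⇒equalStar w e o rewrite withOnes-half⇒balanced m w e o = refl

binom≤census-equalStar-∷ : ∀ m a → binom m m ≤ census (λ w → equalStar (a ∷ w)) (m + m)
binom≤census-equalStar-∷ m a = subst (_≤ census (λ w → equalStar (a ∷ w)) (m + m)) (census-withOnes m m)
  (census-mono (m + m) (withOnes m) (λ w → equalStar (a ∷ w))
    (λ w e o → trans (cong (balanced (a ∷ w) ∨_) (withOnes-half⇒balanced m w e o)) (∨-zeroʳ _)))

census-equalStar-lower : ∀ n → 2 ^ n ≤ census equalStar n * suc n
census-equalStar-lower n with even-or-odd n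
... | m , inj₁ refl = begin
    2 ^ (m + m)                          ≡⟨ 2^[m+m]≡4^m m ⟩
    4 ^ m                                ≤⟨ central-binom-lower m ⟩
    binom m m * (m + suc m)              ≡⟨ cong (binom m m *_) (+-suc m m) ⟩
    binom m m * suc (m + m)              ≤⟨ *-monoˡ-≤ (suc (m + m)) (binom≤census-equalStar-even m) ⟩
    census equalStar (m + m) * suc (m + m) ∎
  where open ≤-Reasoning
... | m , inj₂ refl = begin
    2 * 2 ^ (m + m)                      ≡⟨ cong (2 *_) (2^[m+m]≡4^m m) ⟩
    2 * 4 ^ m                            ≤⟨ *-monoʳ-≤ 2 (central-binom-lower m) ⟩
    2 * (binom m m * (m + suc m))        ≤⟨ *-monoʳ-≤ 2 (*-monoʳ-≤ (binom m m) m+1+m≤2+2m) ⟩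
    2 * (binom m m * suc (suc (m + m)))  ≡⟨ *-assoc 2 (binom m m) _ ⟨
    2 * binom m m * suc (suc (m + m))    ≤⟨ *-monoˡ-≤ _ two-binoms≤census ⟩
    census equalStar (suc (m + m)) * suc (suc (m + m)) ∎
  where
  open ≤-Reasoning
  m+1+m≤2+2m : m + suc m ≤ suc (suc (m + m))
  m+1+m≤2+2m = m≤n⇒m≤1+n (≤-reflexive (+-suc m m))
  two-binoms≤census : 2 * binom m m ≤ census equalStar (suc (m + m))
  two-binoms≤census = begin
    2 * binom m m               ≡⟨ cong (binom m m +_) (+-identityʳ (binom m m)) ⟩
    binom m m + binom m m       ≤⟨ +-mono-≤ (binom≤census-equalStar-∷ m false) (binom≤census-equalStar-∷ m true) ⟩
    census (λ w → equalStar (false ∷ w)) (m + m) + census (λ w → equalStar (true ∷ w)) (m + m)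
                                ≡⟨ census-suc equalStar (m + m) ⟨
    census equalStar (suc (m + m)) ∎

equalStar-dense : PDense equalStar
equalStar-dense = 1 ∷ 1 ∷ [] , here (λ ()) , 0 , λ n _ →
  subst (λ x → 2 ^ n ≤ census equalStar n * x) (sym (eval-1+x n)) (census-equalStar-lower n)
  where
  eval-1+x : ∀ n → eval (1 ∷ 1 ∷ []) n ≡ suc n
  eval-1+x n = cong suc (trans (cong (λ z → n * suc z) (*-zeroʳ n)) (*-identityʳ n))

-- Automata reading a string zipped with advice

++-split : {A : Set} → ∀ a b (g : List A) → length g ≡ a + b →
  Σ (List A) λ g₁ → Σ (List A) λ g₂ → g ≡ g₁ ++ g₂ × length g₁ ≡ a × length g₂ ≡ b
++-split zero    b g       e = [] , g , refl , refl , e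
++-split (suc a) b (x ∷ g) e with ++-split a b g (suc-injective e)
... | g₁ , g₂ , refl , e₁ , e₂ = x ∷ g₁ , g₂ , refl , cong suc e₁ , e₂

zip-++ : {A B : Set} (u v : List A) (g h : List B) → length u ≡ length g →
  zip (u ++ v) (g ++ h) ≡ zip u g ++ zip v h
zip-++ []      v []      h _ = refl
zip-++ (x ∷ u) v (y ∷ g) h e = cong ((x , y) ∷_) (zip-++ u v g h (suc-injective e))

OnesFixed : Lang → ℕ → ℕ → Set
OnesFixed P n j = ∀ w → length w ≡ n → P w ≡ true → ones w ≡ j

census-≤-withOnes : ∀ n P j → OnesFixed P n j → census P n ≤ census (withOnes j) n
census-≤-withOnes n P j fixed =
  census-mono n P (withOnes j) (λ w e p → ≡⇒≡ᵇ-true (ones w) j (fixed w e p))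

module Advised {k : ℕ} (M : DFA (Bool × Fin k)) where

  State : Set
  State = Fin (DFA.states M)

  accFrom : State → List (Fin k) → Lang
  accFrom q g w = DFA.final M (run M q (zip w g))

  run-++ : ∀ q xs ys → run M q (xs ++ ys) ≡ run M (run M q xs) ys
  run-++ q []       ys = refl
  run-++ q (x ∷ xs) ys = run-++ (DFA.δ M q x) xs ys

  accFrom-++ : ∀ q u v g h → length u ≡ length g →
    accFrom q (g ++ h) (u ++ v) ≡ accFrom (run M q (zip u g)) h v
  accFrom-++ q u v g h e =
    cong (DFA.final M) (trans (cong (run M q) (zip-++ u v g h e)) (run-++ q (zip u g) (zip v h)))

  live : List (Fin k) → ℕ → State → Bool
  live g n q = not (census (accFrom q g) n ≡ᵇ 0)

  live⇒witness : ∀ g n q → live g n q ≡ true →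
    Σ (List Bool) λ w → length w ≡ n × accFrom q g w ≡ true
  live⇒witness g n q isLive = census≢0⇒witness n (accFrom q g) ≢0
    where
    ≢0 : census (accFrom q g) n ≢ 0
    ≢0 ≡0 with subst (λ c → not (c ≡ᵇ 0) ≡ true) ≡0 isLive
    ... | ()

  module Prefixes {q : State} {g₁ g₂ : List (Fin k)} {L n j : ℕ} (len₁ : length g₁ ≡ L)
           (fixed : OnesFixed (accFrom q (g₁ ++ g₂)) (L + n) j) where

    after : List Bool → State
    after w₁ = run M q (zip w₁ g₁)

    ones-prefix+suffix : ∀ w₁ w₂ → length w₁ ≡ L → length w₂ ≡ n →
      accFrom (after w₁) g₂ w₂ ≡ true → ones w₁ + ones w₂ ≡ j
    ones-prefix+suffix w₁ w₂ e₁ e₂ acc = begin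
      ones w₁ + ones w₂   ≡⟨ ones-++ w₁ w₂ ⟨
      ones (w₁ ++ w₂)     ≡⟨ fixed (w₁ ++ w₂) (trans (length-++ w₁) (cong₂ _+_ e₁ e₂))
                                   (trans (accFrom-++ q w₁ w₂ g₁ g₂ (trans e₁ (sym len₁))) acc) ⟩
      j                   ∎
      where open ≡-Reasoning

    suffix-ones-fixed : ∀ w₁ → length w₁ ≡ L → OnesFixed (accFrom (after w₁) g₂) n (j ∸ ones w₁)
    suffix-ones-fixed w₁ e₁ w₂ e₂ acc =
      trans (sym (m+n∸m≡n (ones w₁) (ones w₂))) (cong (_∸ ones w₁) (ones-prefix+suffix w₁ w₂ e₁ e₂ acc))

    Live : Lang
    Live w₁ = live g₂ n (after w₁)

    live-fibre-ones-fixed : ∀ i → Σ ℕ λ jᵢ → OnesFixed (fibre _≟ᶠ_ after Live i) L jᵢ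
    live-fibre-ones-fixed i with live g₂ n i in isLive
    ... | false = 0 , λ w₁ _ p →
      let liveAfter , after≡i = fibre-true _≟ᶠ_ after Live i w₁ p
      in ⊥-elim (true≢false (trans (sym liveAfter) (trans (cong (live g₂ n) after≡i) isLive)))
      where
      true≢false : true ≢ false
      true≢false ()
    ... | true = let w₂ , e₂ , acc₂ = live⇒witness g₂ n i isLive in
      j ∸ ones w₂ , λ w₁ e₁ p →
        let _ , after≡i = fibre-true _≟ᶠ_ after Live i w₁ p
        in trans (sym (m+n∸n≡m (ones w₁) (ones w₂)))
                 (cong (_∸ ones w₂) (ones-prefix+suffix w₁ w₂ e₁ e₂
                   (subst (λ q′ → accFrom q′ g₂ w₂ ≡ true) (sym after≡i) acc₂)))

    census-live-prefixes : ∀ X → (∀ j′ → census (withOnes j′) L ≤ X) →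
      census Live L ≤ DFA.states M * X
    census-live-prefixes X withOnes≤X =
      subst (λ s → census Live L ≤ s * X) (length-tabulate {n = DFA.states M} id)
      (census-≤-#fibres _≟ᶠ_ L Live after (allFin (DFA.states M)) X (λ w₁ → ∈-allFin (after w₁))
        (λ i → let jᵢ , fixedᵢ = live-fibre-ones-fixed i in
               ≤-trans (census-≤-withOnes L _ jᵢ fixedᵢ) (withOnes≤X jᵢ)))

  census-blocks : ∀ L X → (∀ j → census (withOnes j) L ≤ X) → 2 * (DFA.states M * X) ≤ 2 ^ L →
    ∀ t g → length g ≡ t * L → ∀ q j → OnesFixed (accFrom q g) (t * L) j →
    census (accFrom q g) (t * L) * 2 ^ t ≤ 2 ^ (t * L)
  census-blocks L X withOnes≤X halving zero g _ q _ fixed with accFrom q g []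
  ... | true  = ≤-refl
  ... | false = z≤n
  census-blocks L X withOnes≤X halving (suc t) g len q j fixed
    with ++-split L (t * L) g len
  ... | g₁ , g₂ , refl , len₁ , len₂ = begin
      census P (L + t * L) * (2 * 2 ^ t)   ≡⟨ *-pull-2 (census P (L + t * L)) (2 ^ t) ⟩
      2 * (census P (L + t * L) * 2 ^ t)   ≤⟨ *-monoʳ-≤ 2 (census-++-≤ L (t * L) P Live (2 ^ t) B prefix-bound) ⟩
      2 * (census Live L * B)              ≤⟨ *-monoʳ-≤ 2 (*-monoˡ-≤ B (census-live-prefixes X withOnes≤X)) ⟩
      2 * (DFA.states M * X * B)           ≡⟨ *-assoc 2 (DFA.states M * X) B ⟨
      2 * (DFA.states M * X) * B           ≤⟨ *-monoˡ-≤ B halving ⟩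
      2 ^ L * B                            ≡⟨ ^-distribˡ-+-* 2 L (t * L) ⟨
      2 ^ (L + t * L)                      ∎
    where
    open ≤-Reasoning
    open Prefixes {q} {g₁} {g₂} {L} {t * L} {j} len₁ fixed
    P = accFrom q (g₁ ++ g₂)
    B = 2 ^ (t * L)
    *-pull-2 : ∀ x y → x * (2 * y) ≡ 2 * (x * y)
    *-pull-2 = solve-∀
    suffix-bound : ∀ w₁ → length w₁ ≡ L →
      census (accFrom (after w₁) g₂) (t * L) * 2 ^ t ≤ (if Live w₁ then B else 0)
    suffix-bound w₁ e₁ with census (accFrom (after w₁) g₂) (t * L) in eq
    ... | zero  = z≤n
    ... | suc _ = subst (λ c → c * 2 ^ t ≤ B) eq
      (census-blocks L X withOnes≤X halving t g₂ len₂ (after w₁) (j ∸ ones w₁)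
        (suffix-ones-fixed w₁ e₁))
    prefix-bound : ∀ w₁ → length w₁ ≡ L →
      census (λ w₂ → P (w₁ ++ w₂)) (t * L) * 2 ^ t ≤ (if Live w₁ then B else 0)
    prefix-bound w₁ e₁ = subst (λ c → c * 2 ^ t ≤ (if Live w₁ then B else 0))
      (census-cong (t * L) _ _ (λ w₂ _ → sym (accFrom-++ q w₁ w₂ g₁ g₂ (trans e₁ (sym len₁)))))
      (suffix-bound w₁ e₁)

coeffSum : Poly → ℕ
coeffSum []       = 0
coeffSum (c ∷ cs) = c + coeffSum cs

eval≤coeffSum*pow : ∀ p x → eval p x ≤ coeffSum p * suc x ^ length p
eval≤coeffSum*pow []       x = z≤n
eval≤coeffSum*pow (c ∷ cs) x = begin
    c + x * eval cs x                          ≤⟨ +-mono-≤ (m≤m*n c (suc x ^ suc d) {{m^n≢0 (suc x) (suc d)}})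
                                                          (*-monoʳ-≤ x (eval≤coeffSum*pow cs x)) ⟩
    c * suc x ^ suc d + x * (coeffSum cs * suc x ^ d)
                                               ≤⟨ +-monoʳ-≤ (c * suc x ^ suc d) (*-monoˡ-≤ _ (n≤1+n x)) ⟩
    c * suc x ^ suc d + suc x * (coeffSum cs * suc x ^ d)
                                               ≡⟨ regroup c (coeffSum cs) x (suc x ^ d) ⟩
    (c + coeffSum cs) * suc x ^ suc d          ∎
  where
  open ≤-Reasoning
  d = length cs
  regroup : ∀ c s x y → c * (suc x * y) + suc x * (s * y) ≡ (c + s) * (suc x * y)
  regroup = solve-∀

n<2^n : ∀ n → n < 2 ^ n
n<2^n zero    = s≤s z≤n
n<2^n (suc n) = +-mono-≤ (m^n>0 2 n) (≤-trans (n<2^n n) (m≤m+n (2 ^ n) 0))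

^-distribʳ-* : ∀ a b d → (a * b) ^ d ≡ a ^ d * b ^ d
^-distribʳ-* a b zero    = refl
^-distribʳ-* a b (suc d) rewrite ^-distribʳ-* a b d = interchange a b (a ^ d) (b ^ d)
  where
  interchange : ∀ a b x y → a * b * (x * y) ≡ a * x * (b * y)
  interchange = solve-∀

quadratic≤2^4K : ∀ K → K + 4 * K * K ≤ 2 ^ (4 * K)
quadratic≤2^4K K = ≤-trans (m≤m+n _ 1) (subst (K + 4 * K * K + 1 ≤_) (^-*-assoc 2 4 K) (go K))
  where
  go : ∀ K → K + 4 * K * K + 1 ≤ 16 ^ K
  go zero    = ≤-refl
  go (suc K) = ≤-trans (≤-trans (m≤m+n _ (60 * K * K + 7 * K + 10)) (≤-reflexive (step K))) (*-monoʳ-≤ 16 (go K))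
    where
    step : ∀ K → suc K + 4 * suc K * suc K + 1 + (60 * K * K + 7 * K + 10) ≡ 16 * (K + 4 * K * K + 1)
    step = solve-∀

-- For t = 2 ^ u we get eval p (t * c) < 2 ^ (A + u * d), and u = 4K with K ≥ A, d makes A + u * d ≤ t.
poly<2^ : ∀ p c n₀ → Σ ℕ λ t → n₀ ≤ t × eval p (t * c) < 2 ^ t
poly<2^ p c n₀ = t , n₀≤t , eval<2^t
  where
  d = length p
  A = coeffSum p * suc c ^ d
  K = A + d + n₀
  u = 4 * K
  t = 2 ^ u
  K≤t : K ≤ t
  K≤t = ≤-trans (m≤n*m K 4) (<⇒≤ (n<2^n u))
  n₀≤t : n₀ ≤ t
  n₀≤t = ≤-trans (m≤n+m n₀ (A + d)) K≤t
  exponent≤t : A + u * d ≤ t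
  exponent≤t = begin
    A + u * d  ≤⟨ +-mono-≤ (≤-trans (m≤m+n A d) (m≤m+n _ n₀)) (*-monoʳ-≤ u (≤-trans (m≤n+m d A) (m≤m+n _ n₀))) ⟩
    K + u * K  ≤⟨ quadratic≤2^4K K ⟩
    t          ∎
    where open ≤-Reasoning
  1+tc≤t[1+c] : suc (t * c) ≤ t * suc c
  1+tc≤t[1+c] = subst (suc (t * c) ≤_) (sym (*-suc t c)) (+-monoˡ-≤ (t * c) (m^n>0 2 u))
  eval<2^t : eval p (t * c) < 2 ^ t
  eval<2^t = begin-strict
    eval p (t * c)                           ≤⟨ eval≤coeffSum*pow p (t * c) ⟩
    coeffSum p * suc (t * c) ^ d             ≤⟨ *-monoʳ-≤ (coeffSum p) (^-monoˡ-≤ d 1+tc≤t[1+c]) ⟩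
    coeffSum p * (t * suc c) ^ d             ≡⟨ cong (coeffSum p *_) (^-distribʳ-* t (suc c) d) ⟩
    coeffSum p * (t ^ d * suc c ^ d)         ≡⟨ cong (λ z → coeffSum p * (z * suc c ^ d)) (^-*-assoc 2 u d) ⟩
    coeffSum p * (2 ^ (u * d) * suc c ^ d)   ≡⟨ regroup (coeffSum p) (2 ^ (u * d)) (suc c ^ d) ⟩
    A * 2 ^ (u * d)                          <⟨ *-monoˡ-< (2 ^ (u * d)) {{m^n≢0 2 (u * d)}} (n<2^n A) ⟩
    2 ^ A * 2 ^ (u * d)                      ≡⟨ ^-distribˡ-+-* 2 A (u * d) ⟨
    2 ^ (A + u * d)                          ≤⟨ ^-monoʳ-≤ 2 exponent≤t ⟩
    2 ^ t                                    ∎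
    where
    open ≤-Reasoning
    regroup : ∀ a b c → a * (b * c) ≡ a * c * b
    regroup = solve-∀

-- Dense subsets of Equal_* are not in REG/n

balanced⇒twice-ones : ∀ w → balanced w ≡ true → 2 * ones w ≡ length w
balanced⇒twice-ones w bal = begin
  ones w + (ones w + 0) ≡⟨ cong (ones w +_) (+-identityʳ (ones w)) ⟩
  ones w + ones w       ≡⟨ cong (_+ ones w) (≡ᵇ-true⇒≡ (occ false w) (ones w) bal) ⟨
  occ false w + ones w  ≡⟨ occ-false+ones w ⟩
  length w              ∎
  where open ≡-Reasoning

equalStar-even-ones : ∀ r w → length w ≡ 2 * r → equalStar w ≡ true → ones w ≡ r
equalStar-even-ones r []      len _ = *-cancelˡ-≡ 0 r 2 len
equalStar-even-ones r (a ∷ w) len w∈ with balanced (a ∷ w) in bal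
... | true  = *-cancelˡ-≡ (ones (a ∷ w)) r 2 (trans (balanced⇒twice-ones (a ∷ w) bal) len)
... | false = ⊥-elim (even≢odd r (ones w) (sym (trans (cong suc (balanced⇒twice-ones w w∈)) len)))

-- With m = 4s² + 1 we have 4s² ≤ 3m + 1, so squaring both sides reduces this to central-binom-upper.
2*s*central-binom≤4^m : ∀ s → let m = suc (4 * (s * s)) in 2 * (s * binom m m) ≤ 2 ^ (m + m)
2*s*central-binom≤4^m s = square-≤⇒≤ (begin
    (2 * (s * X)) * (2 * (s * X))   ≡⟨ regroup s X ⟩
    (4 * (s * s)) * (X * X)         ≤⟨ *-monoˡ-≤ (X * X) (≤-trans (m≤m+n (4 * (s * s)) (8 * (s * s) + 4)) (≤-reflexive (3m+1 s))) ⟩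
    (3 * m + 1) * (X * X)           ≡⟨ *-comm (3 * m + 1) (X * X) ⟩
    X * X * (3 * m + 1)             ≤⟨ central-binom-upper m ⟩
    16 ^ m                          ≡⟨ ^-*-assoc 2 4 m ⟩
    2 ^ (4 * m)                     ≡⟨ cong (2 ^_) (4m≡2m+2m m) ⟩
    2 ^ ((m + m) + (m + m))         ≡⟨ ^-distribˡ-+-* 2 (m + m) (m + m) ⟩
    2 ^ (m + m) * 2 ^ (m + m)       ∎)
  where
  open ≤-Reasoning
  m = suc (4 * (s * s))
  X = binom m m
  regroup : ∀ s X → (2 * (s * X)) * (2 * (s * X)) ≡ (4 * (s * s)) * (X * X)
  regroup = solve-∀
  3m+1 : ∀ s → 4 * (s * s) + (8 * (s * s) + 4) ≡ 3 * suc (4 * (s * s)) + 1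
  3m+1 = solve-∀
  4m≡2m+2m : ∀ m → 4 * m ≡ (m + m) + (m + m)
  4m≡2m+2m = solve-∀
  square-≤⇒≤ : ∀ {a b} → a * a ≤ b * b → a ≤ b
  square-≤⇒≤ {a} {b} a²≤b² with a ≤? b
  ... | yes a≤b = a≤b
  ... | no a≰b  = ⊥-elim (<⇒≱ (*-mono-< (≰⇒> a≰b) (≰⇒> a≰b)) a²≤b²)

REGn⊆equalStar⇒sparse : ∀ S → REGn S → S ⊆ equalStar →
  Σ ℕ λ L → NonZero L × (∀ t → census S (t * L) * 2 ^ t ≤ 2 ^ (t * L))
REGn⊆equalStar⇒sparse S (k , h , M , S≡M) S⊆ = L , _ , λ t →
  subst (λ c → c * 2 ^ t ≤ 2 ^ (t * L)) (sym (census-cong (t * L) S _ (S≡accFrom t)))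
    (census-blocks L (binom m m) (census-withOnes≤central m) (2*s*central-binom≤4^m s)
      t (advice t) (length-toList (h (t * L))) (DFA.start M) (t * m) (ones-fixed t))
  where
  open Advised M
  s = DFA.states M
  m = suc (4 * (s * s))
  L = m + m
  advice : ℕ → List (Fin k)
  advice t = V.toList (h (t * L))
  S≡accFrom : ∀ t w → length w ≡ t * L → S w ≡ accFrom (DFA.start M) (advice t) w
  S≡accFrom t w len = trans (S≡M w) (cong (λ n → accepts M (zip w (V.toList (h n)))) len)
  ones-fixed : ∀ t → OnesFixed (accFrom (DFA.start M) (advice t)) (t * L) (t * m)
  ones-fixed t w len acc = equalStar-even-ones (t * m) w (trans len (t*[m+m]≡2*[t*m] t m))
    (S⊆ w (trans (S≡accFrom t w len) acc))
    where
    t*[m+m]≡2*[t*m] : ∀ t m → t * (m + m) ≡ 2 * (t * m)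
    t*[m+m]≡2*[t*m] = solve-∀

sparse⇒¬PDense : ∀ S L .{{_ : NonZero L}} → (∀ t → census S (t * L) * 2 ^ t ≤ 2 ^ (t * L)) → ¬ PDense S
sparse⇒¬PDense S L sparse (p , _ , n₀ , dense) with poly<2^ p L n₀
... | t , n₀≤t , p<2^t with census S (t * L) in eq | dense (t * L) (≤-trans n₀≤t (m≤m*n t L))
...   | zero  | 2^n≤0 = <⇒≱ (m^n>0 2 (t * L)) 2^n≤0
...   | suc c | 2^n≤ = <⇒≱ (begin-strict
        suc c * eval p (t * L)  <⟨ *-monoʳ-< (suc c) p<2^t ⟩
        suc c * 2 ^ t           ≤⟨ subst (λ c → c * 2 ^ t ≤ 2 ^ (t * L)) eq (sparse t) ⟩
        2 ^ (t * L)             ∎) 2^n≤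
  where open ≤-Reasoning

proposition6p2 : REGn-primeimmune equalStar
proposition6p2 = equalStar-dense , λ (S , S∈REGn , S⊆ , S-dense) →
  let L , L≢0 , sparse = REGn⊆equalStar⇒sparse S S∈REGn S⊆
  in sparse⇒¬PDense S L {{L≢0}} sparse S-dense
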